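{- Let $\mathbb{F}$ be a finite field, let $G$ be a finite simple graph, and let $H$ be the underlying graph of the line digraph $\delta G$. Then $\xi_{\mathbb{F}}(H)\geq \sqrt{\log_{|\mathbb{F}|}\chi(G)}$.
   Context: For $x,y\in\mathbb{F}^k$, $\langle x,y\rangle=\sum_i x_iy_i$ over $\mathbb{F}$. A $k$-dimensional orthogonal representation of a graph $G=(V,E)$ over $\mathbb{F}$ assigns to each $v\in V$ a vector $u_v\in\mathbb{F}^k$ with $\langle u_v,u_v\rangle\neq0$ such that $\langle u_v,u_{v'}\rangle=0$ whenever $v,v'$ are adjacent. The orthogonality dimension $\xi_{\mathbb{F}}(G)$ is the smallest $k$ for which such a representation exists. $\chi$ denotes the chromatic number. The line digraph $\delta G$ of a graph $G$ (each edge viewed as two opposite directed edges) has as vertices all ordered pairs $(x,y)$ with $\{x,y\}$ an edge of $G$, with a directed edge from $(x,y)$ to $(z,w)$ whenever $y=z$; its underlying graph $H$ is obtained by ignoring directions. -}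

module Defs where

open import Level using (Level; _⊔_) renaming (suc to lsuc; zero to lzero)
open import Data.Nat using (ℕ; zero; suc; _≤_; _<_)
open import Data.Fin using (Fin)
open import Data.Product using (Σ; _×_; _,_; ∃; proj₁; proj₂)
open import Data.Sum using (_⊎_; inj₁; inj₂)
open import Relation.Nullary using (¬_)
open import Relation.Binary.PropositionalEquality using (_≡_; refl)
import Relation.Binary.PropositionalEquality as ≡
open import Algebra.Bundles using (CommutativeRing)
open import Function.Bundles using (Bijection)

record IsField {c ℓ : Level} (R : CommutativeRing c ℓ) : Set (c ⊔ ℓ) where
  open CommutativeRing R
  field
    1≉0     : ¬ (1# ≈ 0#)
    inverse : ∀ x → ¬ (x ≈ 0#) → Σ Carrier (λ y → (x * y) ≈ 1#)

record FiniteField (c ℓ : Level) (q : ℕ) : Set (lsuc (c ⊔ ℓ)) where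
  field
    cring   : CommutativeRing c ℓ
    isField : IsField cring
    card    : Bijection (CommutativeRing.setoid cring) (≡.setoid (Fin q))
  open CommutativeRing cring public

record Graph (V : Set) : Set₁ where
  field
    Adj     : V → V → Set
    sym     : ∀ {u v} → Adj u v → Adj v u
    irrefl  : ∀ {u} → ¬ Adj u u

FinGraph : ℕ → Set₁
FinGraph n = Graph (Fin n)

Colouring : ∀ {V} → Graph V → ℕ → Set
Colouring {V} G c = Σ (V → Fin c) λ f → ∀ {u v} → Graph.Adj G u v → ¬ (f u ≡ f v)

IsChromaticNumber : ∀ {V} → Graph V → ℕ → Set
IsChromaticNumber G c = Colouring G c × (∀ d → Colouring G d → c ≤ d)

module _ {c ℓ : Level} {q : ℕ} (F : FiniteField c ℓ q) where
  open FiniteField F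

  ⟨_,_⟩ : ∀ {k} → (Fin k → Carrier) → (Fin k → Carrier) → Carrier
  ⟨_,_⟩ {zero}  x y = 0#
  ⟨_,_⟩ {suc k} x y = (x Fin.zero * y Fin.zero) + ⟨ (λ i → x (Fin.suc i)) , (λ i → y (Fin.suc i)) ⟩

  OrthRep : ∀ {V} → Graph V → ℕ → Set (c ⊔ ℓ)
  OrthRep {V} G k =
    Σ (V → (Fin k → Carrier)) λ u →
      (∀ v → ¬ (⟨ u v , u v ⟩ ≈ 0#)) ×
      (∀ {v v'} → Graph.Adj G v v' → ⟨ u v , u v' ⟩ ≈ 0#)

  IsOrthDim : ∀ {V} → Graph V → ℕ → Set (c ⊔ ℓ)
  IsOrthDim G k = OrthRep G k × (∀ d → OrthRep G d → k ≤ d)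

DVertex : ∀ {V} → Graph V → Set
DVertex {V} G = Σ (V × V) λ p → Graph.Adj G (proj₁ p) (proj₂ p)

DArc : ∀ {V} (G : Graph V) → DVertex G → DVertex G → Set
DArc G ((x , y) , _) ((z , w) , _) = y ≡ z

underlying-irrefl : ∀ {V} (G : Graph V) {a : DVertex G} → ¬ (DArc G a a ⊎ DArc G a a)
underlying-irrefl G {(x , .x) , e} (inj₁ refl) = Graph.irrefl G e
underlying-irrefl G {(x , .x) , e} (inj₂ refl) = Graph.irrefl G e

lineDigraphUnderlying : ∀ {V} (G : Graph V) → Graph (DVertex G)
lineDigraphUnderlying G = record
  { Adj    = λ a b → DArc G a b ⊎ DArc G b a
  ; sym    = λ { (inj₁ p) → inj₂ p ; (inj₂ p) → inj₁ p }
  ; irrefl = λ {a} → underlying-irrefl G {a}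
  }

{-# OPTIONS --safe #-}
-- Colour a vertex x of G by the subspace A_x ⊆ 𝔽^ξ of vectors orthogonal to u_(x,z) for
-- every arc (x , z) of δG. If x ~ y, then u_(x,y) is orthogonal to every u_(y,z), so it
-- lies in A_y, but it is not self-orthogonal, so it is not in A_x: the colouring is
-- proper. There are at most ∏_{i<ξ} (1 + q^i) ≤ q^(ξ²) subspaces of 𝔽^ξ.
-- Adjacency in G need not be decidable, but the conclusion is, so by double-negation
-- stability we may assume it.
module Submission where

open import Defs
open import Level using (Level; _⊔_) renaming (suc to lsuc)
open import Data.Nat using (ℕ; zero; suc; _≤_; _^_; _*_; z≤n; s≤s)
import Data.Nat as ℕ
import Data.Nat.Properties as ℕₚ
open import Data.Fin using (Fin; zero; suc; combine; funToFin; finToFun)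
open import Data.Fin.Properties using (combine-injective; finToFun-funToFin; any?; all?; ∀-cons)
open import Data.Vec.Functional using (Vector; _∷_; head; tail; map; zipWith; replicate)
import Data.Vec.Functional.Relation.Binary.Equality.Setoid as VecSetoid
open import Data.Product using (∃; _,_; proj₁; proj₂)
open import Data.Sum using (inj₁)
open import Function using (_∘_)
open import Function.Bundles using (Bijection)
open import Relation.Nullary using (¬_; Dec; yes; no; contradiction)
open import Relation.Nullary.Decidable using (decidable-stable; ¬¬-excluded-middle)
open import Relation.Nullary.Negation using (¬¬-map)
open import Relation.Unary using (Pred; _⊆_)
open import Relation.Binary.PropositionalEquality as ≡ using (_≡_; _≢_)
import Relation.Binary.Reasoning.Setoid as SetoidReasoning
import Algebra.Properties.CommutativeSemigroup as CommSemigroupProperties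

¬¬-∀-Fin : ∀ {n p} {P : Fin n → Set p} → (∀ i → ¬ ¬ P i) → ¬ ¬ (∀ i → P i)
¬¬-∀-Fin {zero}  h ¬∀ = ¬∀ (λ ())
¬¬-∀-Fin {suc n} h ¬∀ = h zero (λ p₀ → ¬¬-∀-Fin (h ∘ suc) (λ p₊ → ¬∀ (∀-cons p₀ p₊)))

≢⇒2≤ : ∀ {m} {i j : Fin m} → i ≢ j → 2 ≤ m
≢⇒2≤ {i = zero}  {zero}  i≢j = contradiction ≡.refl i≢j
≢⇒2≤ {suc (suc m)} {zero}  {suc j} _ = s≤s (s≤s z≤n)
≢⇒2≤ {suc (suc m)} {suc i} {zero}  _ = s≤s (s≤s z≤n)
≢⇒2≤ {i = suc i} {suc j} i≢j = ℕₚ.m≤n⇒m≤1+n (≢⇒2≤ (i≢j ∘ ≡.cong suc))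

-- ∏_{i<k} (1 + q^i): a subspace of 𝔽_q^k is determined by choosing, coordinate by
-- coordinate, either no pivot or one of the q^i possible pivot rows.
subspaceCount : ℕ → ℕ → ℕ
subspaceCount q zero    = 1
subspaceCount q (suc k) = suc (q ^ k) * subspaceCount q k

1+q^k≤q^[1+k] : ∀ {q} → 2 ≤ q → ∀ k → suc (q ^ k) ≤ q ^ suc k
1+q^k≤q^[1+k] {suc zero} (s≤s ()) k
1+q^k≤q^[1+k] {suc (suc r)} _ k = begin
  1 ℕ.+ q ^ k               ≤⟨ ℕₚ.+-monoˡ-≤ (q ^ k) (ℕₚ.m^n>0 q k) ⟩
  q ^ k ℕ.+ q ^ k           ≤⟨ ℕₚ.+-monoʳ-≤ (q ^ k) (ℕₚ.m≤m+n (q ^ k) (r * q ^ k)) ⟩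
  q ^ k ℕ.+ suc r * q ^ k   ∎
  where
  open ℕₚ.≤-Reasoning
  q : ℕ
  q = suc (suc r)

subspaceCount≤q^k² : ∀ {q} → 2 ≤ q → ∀ k → subspaceCount q k ≤ q ^ (k * k)
subspaceCount≤q^k² 2≤q zero = ℕₚ.≤-refl
subspaceCount≤q^k² {zero} () (suc k)
subspaceCount≤q^k² {suc q-1} 2≤q (suc k) = begin
  suc (q ^ k) * subspaceCount q k  ≤⟨ ℕₚ.*-mono-≤ (1+q^k≤q^[1+k] 2≤q k) (subspaceCount≤q^k² 2≤q k) ⟩
  q ^ suc k * q ^ (k * k)          ≡⟨ ≡.sym (ℕₚ.^-distribˡ-+-* q (suc k) (k * k)) ⟩
  q ^ (suc k ℕ.+ k * k)            ≤⟨ ℕₚ.^-monoʳ-≤ q (ℕₚ.+-monoʳ-≤ (suc k) k*k≤k*[1+k]) ⟩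
  q ^ (suc k * suc k)              ∎
  where
  open ℕₚ.≤-Reasoning
  k*k≤k*[1+k] : k * k ≤ k * suc k
  k*k≤k*[1+k] = ℕₚ.*-monoʳ-≤ k (ℕₚ.n≤1+n k)
  q : ℕ
  q = suc q-1

module _ {c ℓ : Level} {q : ℕ} (F : FiniteField c ℓ q) where
  open FiniteField F hiding (zero) renaming (_*_ to _·_)
  open IsField isField
  open VecSetoid setoid using (_≋_; ≋-refl; ≋-sym)

  toFin : Carrier → Fin q
  toFin = Bijection.to card

  fromFin : Fin q → Carrier
  fromFin i = proj₁ (Bijection.surjective card i)

  fromFin-toFin : ∀ x → fromFin (toFin x) ≈ x
  fromFin-toFin x = Bijection.injective card (proj₂ (Bijection.surjective card (toFin x)) refl)

  _≟_ : ∀ x y → Dec (x ≈ y)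
  x ≟ y with toFin x Data.Fin.≟ toFin y
  ... | yes eq = yes (Bijection.injective card eq)
  ... | no neq = no (neq ∘ Bijection.cong card)

  2≤q : 2 ≤ q
  2≤q = ≢⇒2≤ (1≉0 ∘ Bijection.injective card)

  infix  4 _≟_
  infix  8 _∙_
  infixl 6 _+ᵛ_
  infixr 7 _·ᵛ_

  0ᵛ : ∀ {k} → Vector Carrier k
  0ᵛ = replicate _ 0#

  _+ᵛ_ : ∀ {k} → Vector Carrier k → Vector Carrier k → Vector Carrier k
  _+ᵛ_ = zipWith _+_

  _·ᵛ_ : ∀ {k} → Carrier → Vector Carrier k → Vector Carrier k
  a ·ᵛ v = map (a ·_) v

  ≋-∷ : ∀ {k} {v : Vector Carrier (suc k)} {x t} → head v ≈ x → tail v ≋ t → v ≋ x ∷ t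
  ≋-∷ v₀≈x v₊≋t zero    = v₀≈x
  ≋-∷ v₀≈x v₊≋t (suc i) = v₊≋t i

  decode : ∀ {k} → Fin (q ^ k) → Vector Carrier k
  decode i = map fromFin (finToFun i)

  encode : ∀ {k} → Vector Carrier k → Fin (q ^ k)
  encode v = funToFin (map toFin v)

  decode-encode : ∀ {k} (v : Vector Carrier k) → decode (encode v) ≋ v
  decode-encode v i = trans (reflexive (≡.cong fromFin (finToFun-funToFin (map toFin v) i))) (fromFin-toFin (v i))

  _∙_ : ∀ {k} → Vector Carrier k → Vector Carrier k → Carrier
  v ∙ w = ⟨_,_⟩ F v w

  ∙-zeroˡ : ∀ {k} (y : Vector Carrier k) → 0ᵛ ∙ y ≈ 0#
  ∙-zeroˡ {zero}  y = refl
  ∙-zeroˡ {suc k} y = trans (+-cong (zeroˡ (head y)) (∙-zeroˡ (tail y))) (+-identityʳ 0#)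

  ∙-zeroʳ : ∀ {k} (v : Vector Carrier k) → v ∙ 0ᵛ ≈ 0#
  ∙-zeroʳ {zero}  v = refl
  ∙-zeroʳ {suc k} v = trans (+-cong (zeroʳ (head v)) (∙-zeroʳ (tail v))) (+-identityʳ 0#)

  ∙-congˡ : ∀ {k} {v w : Vector Carrier k} (y : Vector Carrier k) → v ≋ w → v ∙ y ≈ w ∙ y
  ∙-congˡ {zero}  y v≋w = refl
  ∙-congˡ {suc k} y v≋w = +-cong (*-congʳ (v≋w zero)) (∙-congˡ (tail y) (v≋w ∘ suc))

  ∙-distribʳ-+ᵛ : ∀ {k} (v w y : Vector Carrier k) → (v +ᵛ w) ∙ y ≈ v ∙ y + w ∙ y
  ∙-distribʳ-+ᵛ {zero}  v w y = sym (+-identityʳ 0#)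
  ∙-distribʳ-+ᵛ {suc k} v w y =
    trans (+-cong (distribʳ (head y) (head v) (head w)) (∙-distribʳ-+ᵛ (tail v) (tail w) (tail y)))
          (interchange (head v · head y) (head w · head y) (tail v ∙ tail y) (tail w ∙ tail y))
    where open CommSemigroupProperties +-commutativeSemigroup using (interchange)

  ·ᵛ-∙-assoc : ∀ {k} a (v y : Vector Carrier k) → (a ·ᵛ v) ∙ y ≈ a · (v ∙ y)
  ·ᵛ-∙-assoc {zero}  a v y = sym (zeroʳ a)
  ·ᵛ-∙-assoc {suc k} a v y =
    trans (+-cong (*-assoc a (head v) (head y)) (·ᵛ-∙-assoc a (tail v) (tail y)))
          (sym (distribˡ a (head v · head y) (tail v ∙ tail y)))

  record Subspace (k : ℕ) : Set (c ⊔ lsuc ℓ) where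
    field
      Member      : Pred (Vector Carrier k) ℓ
      member?     : ∀ v → Dec (Member v)
      member-resp : ∀ {v w} → v ≋ w → Member v → Member w
      0ᵛ-closed   : Member 0ᵛ
      +ᵛ-closed   : ∀ {v w} → Member v → Member w → Member (v +ᵛ w)
      ·ᵛ-closed   : ∀ a {v} → Member v → Member (a ·ᵛ v)

  open Subspace

  _⊆ˢ_ : ∀ {k} → Subspace k → Subspace k → Set (c ⊔ ℓ)
  S ⊆ˢ T = Member S ⊆ Member T

  headZeroSlice : ∀ {k} → Subspace (suc k) → Subspace k
  headZeroSlice S = record
    { Member      = λ t → Member S (0# ∷ t)
    ; member?     = λ t → member? S (0# ∷ t)
    ; member-resp = λ t≋t′ → member-resp S (≋-∷ refl t≋t′)
    ; 0ᵛ-closed   = member-resp S (≋-∷ refl ≋-refl) (0ᵛ-closed S)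
    ; +ᵛ-closed   = λ v∈ w∈ → member-resp S (≋-∷ (+-identityʳ 0#) ≋-refl) (+ᵛ-closed S v∈ w∈)
    ; ·ᵛ-closed   = λ a v∈ → member-resp S (≋-∷ (zeroʳ a) ≋-refl) (·ᵛ-closed S a v∈)
    }

  ⊆-on-head≈0 : ∀ {k} (S T : Subspace (suc k)) → headZeroSlice S ⊆ˢ headZeroSlice T →
                ∀ {v} → head v ≈ 0# → Member S v → Member T v
  ⊆-on-head≈0 S T slice⊆ {v} v₀≈0 v∈S =
    member-resp T (≋-sym v≋0∷v₊) (slice⊆ (member-resp S v≋0∷v₊ v∈S))
    where
    v≋0∷v₊ : v ≋ 0# ∷ tail v
    v≋0∷v₊ = ≋-∷ v₀≈0 ≋-refl

  head≈0-without-pivot : ∀ {k} (S : Subspace (suc k)) → (∀ s → ¬ Member S (1# ∷ s)) →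
                         ∀ {v} → Member S v → head v ≈ 0#
  head≈0-without-pivot S no-pivot {v} v∈S with head v ≟ 0#
  ... | yes v₀≈0 = v₀≈0
  ... | no v₀≉0 =
    let b , v₀b≈1 = inverse (head v) v₀≉0
    in  contradiction (member-resp S (≋-∷ (trans (*-comm b (head v)) v₀b≈1) ≋-refl) (·ᵛ-closed S b v∈S))
                      (no-pivot _)

  ⊆-without-pivot : ∀ {k} (S T : Subspace (suc k)) → (∀ s → ¬ Member S (1# ∷ s)) →
                    headZeroSlice S ⊆ˢ headZeroSlice T → S ⊆ˢ T
  ⊆-without-pivot S T no-pivot slice⊆ v∈S =
    ⊆-on-head≈0 S T slice⊆ (head≈0-without-pivot S no-pivot v∈S) v∈S

  x-ay+ay≈x : ∀ a x y → (x + - a · y) + a · y ≈ x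
  x-ay+ay≈x a x y = begin
    (x + - a · y) + a · y  ≈⟨ +-assoc x (- a · y) (a · y) ⟩
    x + (- a · y + a · y)  ≈⟨ +-congˡ (distribʳ y (- a) a) ⟨
    x + (- a + a) · y      ≈⟨ +-congˡ (*-congʳ (-‿inverseˡ a)) ⟩
    x + 0# · y             ≈⟨ +-congˡ (zeroˡ y) ⟩
    x + 0#                 ≈⟨ +-identityʳ x ⟩
    x                      ∎
    where open SetoidReasoning setoid

  -- v = (v − (head v)·(1 ∷ s)) + (head v)·(1 ∷ s), and the first summand has head 0.
  ⊆-via-pivot : ∀ {k} (S T : Subspace (suc k)) {s} → Member S (1# ∷ s) → Member T (1# ∷ s) →
                headZeroSlice S ⊆ˢ headZeroSlice T → S ⊆ˢ T
  ⊆-via-pivot {k} S T {s} p∈S p∈T slice⊆ {v} v∈S =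
    member-resp T (λ i → x-ay+ay≈x a (v i) ((1# ∷ s) i)) (+ᵛ-closed T w∈T (·ᵛ-closed T a p∈T))
    where
    a : Carrier
    a = head v
    w : Vector Carrier (suc k)
    w = v +ᵛ (- a ·ᵛ (1# ∷ s))
    w₀≈0 : head w ≈ 0#
    w₀≈0 = trans (+-congˡ (*-identityʳ (- a))) (-‿inverseʳ a)
    w∈T : Member T w
    w∈T = ⊆-on-head≈0 S T slice⊆ w₀≈0 (+ᵛ-closed S v∈S (·ᵛ-closed S (- a) p∈S))

  PivotIndex : ∀ {k} → Subspace (suc k) → Pred (Fin (q ^ k)) ℓ
  PivotIndex S i = Member S (1# ∷ decode i)

  pivot? : ∀ {k} (S : Subspace (suc k)) → Dec (∃ (PivotIndex S))
  pivot? S = any? (λ i → member? S (1# ∷ decode i))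

  pivotCode : ∀ {k} (S : Subspace (suc k)) → Dec (∃ (PivotIndex S)) → Fin (suc (q ^ k))
  pivotCode S (yes (i , _)) = suc i
  pivotCode S (no _)        = zero

  ¬pivot⇒¬1∷s∈ : ∀ {k} (S : Subspace (suc k)) → ¬ ∃ (PivotIndex S) → ∀ s → ¬ Member S (1# ∷ s)
  ¬pivot⇒¬1∷s∈ S no-pivot s p∈S =
    no-pivot (encode s , member-resp S (≋-∷ refl (≋-sym (decode-encode s))) p∈S)

  ⊆-of-pivotCode : ∀ {k} (S T : Subspace (suc k)) →
                   (dS : Dec (∃ (PivotIndex S))) (dT : Dec (∃ (PivotIndex T))) →
                   pivotCode S dS ≡ pivotCode T dT → headZeroSlice S ⊆ˢ headZeroSlice T → S ⊆ˢ T
  ⊆-of-pivotCode S T (yes (i , p∈S)) (yes (.i , p∈T)) ≡.refl = ⊆-via-pivot S T p∈S p∈T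
  ⊆-of-pivotCode S T (no no-pivot)   (no _)           _      = ⊆-without-pivot S T (¬pivot⇒¬1∷s∈ S no-pivot)

  echelonCode : ∀ {k} → Subspace k → Fin (subspaceCount q k)
  echelonCode {zero}  S = zero
  echelonCode {suc k} S = combine (pivotCode S (pivot? S)) (echelonCode (headZeroSlice S))

  echelonCode-⊆ : ∀ {k} (S T : Subspace k) → echelonCode S ≡ echelonCode T → S ⊆ˢ T
  echelonCode-⊆ {zero}  S T _  _ = member-resp T (λ ()) (0ᵛ-closed T)
  echelonCode-⊆ {suc k} S T eq =
    let pivots≡ , slices≡ = combine-injective (pivotCode S (pivot? S)) (echelonCode S₀)
                                              (pivotCode T (pivot? T)) (echelonCode T₀) eq
    in  ⊆-of-pivotCode S T (pivot? S) (pivot? T) pivots≡ (echelonCode-⊆ S₀ T₀ slices≡)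
    where
    S₀ T₀ : Subspace k
    S₀ = headZeroSlice S
    T₀ = headZeroSlice T

  orthogonalComplement : ∀ {k m} → (Fin m → Vector Carrier k) → Subspace k
  orthogonalComplement y = record
    { Member      = λ v → ∀ j → v ∙ y j ≈ 0#
    ; member?     = λ v → all? (λ j → v ∙ y j ≟ 0#)
    ; member-resp = λ v≋w v⊥ j → trans (sym (∙-congˡ (y j) v≋w)) (v⊥ j)
    ; 0ᵛ-closed   = λ j → ∙-zeroˡ (y j)
    ; +ᵛ-closed   = λ {v} {w} v⊥ w⊥ j →
        trans (∙-distribʳ-+ᵛ v w (y j)) (trans (+-cong (v⊥ j) (w⊥ j)) (+-identityʳ 0#))
    ; ·ᵛ-closed   = λ a {v} v⊥ j → trans (·ᵛ-∙-assoc a v (y j)) (trans (*-congˡ (v⊥ j)) (zeroʳ a))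
    }

  module LineDigraphColouring {n k} (G : FinGraph n) (adj? : ∀ x z → Dec (Graph.Adj G x z))
                              (ρ : OrthRep F (lineDigraphUnderlying G) k) where
    open Graph G using (Adj)

    u : DVertex G → Vector Carrier k
    u = proj₁ ρ

    -- Non-arcs get 0ᵛ, which is orthogonal to everything and so does not constrain outArcs⊥ x.
    arcVector : ∀ x z → Dec (Adj x z) → Vector Carrier k
    arcVector x z (yes e) = u ((x , z) , e)
    arcVector x z (no _)  = 0ᵛ

    outArcs⊥ : Fin n → Subspace k
    outArcs⊥ x = orthogonalComplement (λ z → arcVector x z (adj? x z))

    consecutive-arcs-orthogonal : ∀ {x y z} (d : Dec (Adj x y)) (d′ : Dec (Adj y z)) →
                                  arcVector x y d ∙ arcVector y z d′ ≈ 0#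
    consecutive-arcs-orthogonal (yes e) (yes e′) = proj₂ (proj₂ ρ) (inj₁ ≡.refl)
    consecutive-arcs-orthogonal (yes e) (no _)   = ∙-zeroʳ (u (_ , e))
    consecutive-arcs-orthogonal {y = y} {z} (no _) d′ = ∙-zeroˡ (arcVector y z d′)

    arcVector-nonisotropic : ∀ {x y} → Adj x y → (d : Dec (Adj x y)) →
                             ¬ (arcVector x y d ∙ arcVector x y d ≈ 0#)
    arcVector-nonisotropic _   (yes e) = proj₁ (proj₂ ρ) _
    arcVector-nonisotropic x~y (no x≁y) = contradiction x~y x≁y

    proper : ∀ {x y} → Adj x y → echelonCode (outArcs⊥ x) ≢ echelonCode (outArcs⊥ y)
    proper {x} {y} x~y eq = arcVector-nonisotropic x~y (adj? x y) (w∈outArcs⊥x y)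
      where
      w∈outArcs⊥x : Member (outArcs⊥ x) (arcVector x y (adj? x y))
      w∈outArcs⊥x = echelonCode-⊆ (outArcs⊥ y) (outArcs⊥ x) (≡.sym eq)
                      (λ z → consecutive-arcs-orthogonal (adj? x y) (adj? y z))

    colouring : Colouring G (subspaceCount q k)
    colouring = (λ x → echelonCode (outArcs⊥ x)) , proper

theorem3p5 : ∀ {c ℓ : Level} {q n : ℕ} (F : FiniteField c ℓ q) (G : FinGraph n)
    (χ ξ : ℕ) → IsChromaticNumber G χ → IsOrthDim F (lineDigraphUnderlying G) ξ →
    χ ≤ q ^ (ξ * ξ)
theorem3p5 {q = q} F G χ ξ (_ , χ-minimal) (ρ , _) =
  decidable-stable (χ ℕₚ.≤? q ^ (ξ * ξ)) (¬¬-map χ≤ adjacency-¬¬decidable)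
  where
  adjacency-¬¬decidable : ¬ ¬ (∀ x z → Dec (Graph.Adj G x z))
  adjacency-¬¬decidable = ¬¬-∀-Fin (λ x → ¬¬-∀-Fin (λ z → ¬¬-excluded-middle))
  χ≤ : (∀ x z → Dec (Graph.Adj G x z)) → χ ≤ q ^ (ξ * ξ)
  χ≤ adj? = ℕₚ.≤-trans (χ-minimal _ (LineDigraphColouring.colouring F G adj? ρ))
                       (subspaceCount≤q^k² (2≤q F) ξ)
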